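{- Assume the Continuum Hypothesis. There is a binary tree with tops with bipartition $(\mathbb{N},B)$ (the countable side identified with $\mathbb{N}$) such that the family $\{N(b): b\in B\}$ of neighbourhoods of the vertices of $B$ is not a tree family.
   Context: A binary tree with tops is any graph isomorphic to one obtained as follows: let $A=2^{<\omega}$ (finite binary sequences ordered by extension), let $B$ be a set of $\aleph_1$ many distinct branches of $A$, and join each $b\in B$ to infinitely many nodes on its branch, with no other edges. For $X,Y\subseteq\mathbb{N}$, $X\subseteq^* Y$ means $X\setminus Y$ is finite and $X=^*Y$ means the symmetric difference is finite. An almost disjoint (AD) family is a family of infinite subsets of $\mathbb{N}$ any two distinct members of which have finite intersection. A tree order of countable height on $\mathbb{N}$ is a partial order on $\mathbb{N}$ with a least element in which all predecessor sets are well-ordered of countable order type; a branch is a maximal chain. An uncountable AD-family $\mathcal{A}$ is a tree family if there is a tree order of countable height on $\mathbb{N}$ such that every $A\in\mathcal{A}$ is almost equal ($=^*$) to some branch of it. -}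

module Defs where

open import Data.Nat using (ℕ; zero; suc; _≤_; _<_)
open import Data.Bool using (Bool; true; false; _∧_)
open import Data.List using (List; []; _∷_; length)
open import Data.Product using (Σ; ∃; _×_; _,_; proj₁)
open import Data.Sum using (_⊎_)
open import Relation.Nullary using (¬_)
open import Relation.Binary.PropositionalEquality using (_≡_)
open import Induction.WellFounded using (WellFounded)
open import Function.Bundles using (_⤖_; Bijection)

Subset : Set
Subset = ℕ → Bool

_≈_ : Subset → Subset → Set
X ≈ Y = ∀ n → X n ≡ Y n

Infinite : Subset → Set
Infinite X = ∀ N → ∃ λ n → N ≤ n × X n ≡ true

_=*_ : Subset → Subset → Set
X =* Y = ∃ λ N → ∀ n → N ≤ n → X n ≡ Y n

FiniteInter : Subset → Subset → Set
FiniteInter X Y = ∃ λ N → ∀ n → N ≤ n → (X n ∧ Y n) ≡ false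

Family : Set₁
Family = Subset → Set

-- Countable family (possibly empty; Subset is inhabited so a surjection
-- from ℕ onto the members exists in that case too).
Countable : Family → Set
Countable P = Σ (ℕ → Subset) λ f → ∀ X → P X → ∃ λ n → f n ≈ X

Uncountable : Family → Set
Uncountable P = ¬ Countable P

IsWellOrderOn : Family → (Subset → Subset → Set) → Set
IsWellOrderOn P R =
    (∀ x y x' y' → R x y → x ≈ x' → y ≈ y' → R x' y')
  × (∀ x → P x → ¬ R x x)
  × (∀ x y z → P x → P y → P z → R x y → R y z → R x z)
  × (∀ x y → P x → P y → R x y ⊎ x ≈ y ⊎ R y x)
  × WellFounded {A = Σ Subset P} (λ a b → R (proj₁ a) (proj₁ b))

-- P has cardinality ℵ₁: it is uncountable and carries a well-order all of
-- whose proper initial segments are countable (i.e. order type ω₁).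
HasSizeAleph1 : Family → Set₁
HasSizeAleph1 P =
  Uncountable P ×
  Σ (Subset → Subset → Set) λ R →
    IsWellOrderOn P R × (∀ x → P x → Countable (λ y → P y × R y x))

CH : Set₁
CH = HasSizeAleph1 (λ _ → Subset)

-- Binary tree 2^{<ω}: nodes are finite binary sequences; branches are
-- infinite binary sequences ℕ → Bool.
prefix : (ℕ → Bool) → ℕ → List Bool
prefix b zero = []
prefix b (suc k) = b 0 ∷ prefix (λ i → b (suc i)) k

OnBranch : (ℕ → Bool) → List Bool → Set
OnBranch b s = s ≡ prefix b (length s)

-- Binary tree with tops, with bipartition (ℕ, B): the countable side ℕ is
-- identified with 2^{<ω} by the bijection e; B is a set of ℵ₁ branches,
-- and the neighbourhood of the top b is N b, an infinite set of nodes on b.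
-- (There are no other edges, so N b is exactly the neighbourhood of b.)
IsBinaryTreeWithTops : (ℕ ⤖ List Bool) → Family → (Subset → Subset) → Set₁
IsBinaryTreeWithTops e B N =
  HasSizeAleph1 B ×
  (∀ b → B b → Infinite (N b) ×
     (∀ n → N b n ≡ true → OnBranch b (Bijection.to e n)))

NbhdFamily : Family → (Subset → Subset) → Family
NbhdFamily B N X = Σ Subset λ b → B b × (X ≈ N b)

IsAD : Family → Set
IsAD 𝒜 = (∀ X → 𝒜 X → Infinite X)
       × (∀ X Y → 𝒜 X → 𝒜 Y → ¬ (X ≈ Y) → FiniteInter X Y)

-- Tree order of countable height on ℕ: a partial order with a least
-- element in which every predecessor set is well-ordered (its order type is
-- automatically countable, as ℕ is countable).
IsTreeOrder : (ℕ → ℕ → Set) → Set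
IsTreeOrder _≼_ =
    (∀ n → n ≼ n)
  × (∀ m n → m ≼ n → n ≼ m → m ≡ n)
  × (∀ k m n → k ≼ m → m ≼ n → k ≼ n)
  × (∃ λ r → ∀ n → r ≼ n)
  × (∀ n → (∀ x y → x ≼ n → y ≼ n → x ≼ y ⊎ y ≼ x)
         × WellFounded {A = Σ ℕ (λ m → m ≼ n)}
             (λ a b → proj₁ a ≼ proj₁ b × ¬ (proj₁ a ≡ proj₁ b)))

IsChain : (ℕ → ℕ → Set) → Subset → Set
IsChain _≼_ C = ∀ x y → C x ≡ true → C y ≡ true → x ≼ y ⊎ y ≼ x

IsBranch : (ℕ → ℕ → Set) → Subset → Set
IsBranch _≼_ C = IsChain _≼_ C ×
  (∀ C' → IsChain _≼_ C' → (∀ n → C n ≡ true → C' n ≡ true)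
        → ∀ n → C' n ≡ true → C n ≡ true)

IsTreeFamily : Family → Set₁
IsTreeFamily 𝒜 =
  Uncountable 𝒜 × IsAD 𝒜 ×
  Σ (ℕ → ℕ → Set) λ _≼_ → IsTreeOrder _≼_ ×
    (∀ X → 𝒜 X → ∃ λ C → IsBranch _≼_ C × X =* C)

module Submission where

-- Under CH the set of all branches of 2^{<ω} has size ℵ₁, so we may take B to be
-- all of them.  Through a pairing function every branch b also codes a binary
-- relation R_b on ℕ, and every tree order on ℕ is some R_b.  The neighbourhood
-- N(b) is a set of nodes on b chosen to defeat R_b: an infinite subset almost
-- equal to no branch of R_b if there is one, all nodes of b otherwise.  If the
-- neighbourhoods formed a tree family for ≼ = R_b, then N(b) would be almost a
-- branch C of ≼.  But an infinite set S almost equal to a branch C has an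
-- infinite subset almost equal to no branch: by well-foundedness of predecessor
-- sets the chain S ∩ C contains z₀ ≺ z₁ ≺ ⋯ increasing in ℕ, and {z_{2k}} omits
-- z_{2k+1} ≼ z_{2k+2}, whereas branches are downward closed.  So in both cases
-- N(b) is almost equal to no branch of ≼.

open import Defs
open import Axiom.ExcludedMiddle using (ExcludedMiddle)
open import Data.Bool using (Bool; true; false; _∧_)
open import Data.Bool.Properties using (∧-conicalˡ; ∧-conicalʳ) renaming (_≟_ to _≟ᵇ_)
open import Data.Empty using (⊥; ⊥-elim)
open import Data.List using (List; []; _∷_; length; replicate; _++_)
open import Data.List.Properties using (≡-dec; length-replicate)
open import Data.Nat using (ℕ; zero; suc; _+_; _*_; _≤_; _<_; z≤n; s≤s)
open import Data.Nat.Binary as ℕᵇ using (ℕᵇ; 2[1+_]; 1+[2_])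
open import Data.Nat.Binary.Properties using (toℕ-fromℕ; fromℕ-toℕ)
open import Data.Nat.Properties
open import Data.Product using (Σ; ∃; ∃₂; _×_; _,_; proj₁; proj₂; map₁; swap)
open import Data.Sum using (_⊎_; inj₁; inj₂)
import Data.Sum as Sum
open import Function.Base using (_∘_)
open import Function.Bundles using (_⤖_; mk↔ₛ′)
open import Function.Properties.Inverse using (↔⇒⤖)
open import Induction.WellFounded using (WellFounded; Acc; acc)
open import Level using (0ℓ)
open import Relation.Binary using (_⇒_; _⇔_; tri<; tri≈; tri>)
open import Relation.Binary.PropositionalEquality
open import Relation.Nullary using (¬_; Dec; yes; no; does; contradiction)
open import Relation.Nullary.Decidable using (dec-true)

bitsOf : ℕᵇ → List Bool
bitsOf ℕᵇ.zero   = []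
bitsOf 2[1+ x ] = true ∷ bitsOf x
bitsOf 1+[2 x ] = false ∷ bitsOf x

fromBits : List Bool → ℕᵇ
fromBits []          = ℕᵇ.zero
fromBits (true ∷ l)  = 2[1+ fromBits l ]
fromBits (false ∷ l) = 1+[2 fromBits l ]

bitsOf-fromBits : ∀ l → bitsOf (fromBits l) ≡ l
bitsOf-fromBits []          = refl
bitsOf-fromBits (true ∷ l)  = cong (true ∷_) (bitsOf-fromBits l)
bitsOf-fromBits (false ∷ l) = cong (false ∷_) (bitsOf-fromBits l)

fromBits-bitsOf : ∀ x → fromBits (bitsOf x) ≡ x
fromBits-bitsOf ℕᵇ.zero   = refl
fromBits-bitsOf 2[1+ x ] = cong 2[1+_] (fromBits-bitsOf x)
fromBits-bitsOf 1+[2 x ] = cong 1+[2_] (fromBits-bitsOf x)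

node : ℕ → List Bool
node = bitsOf ∘ ℕᵇ.fromℕ

index : List Bool → ℕ
index = ℕᵇ.toℕ ∘ fromBits

node-index : ∀ l → node (index l) ≡ l
node-index l = trans (cong bitsOf (fromℕ-toℕ (fromBits l))) (bitsOf-fromBits l)

index-node : ∀ n → index (node n) ≡ n
index-node n = trans (cong ℕᵇ.toℕ (fromBits-bitsOf (ℕᵇ.fromℕ n))) (toℕ-fromℕ n)

ℕ⤖nodes : ℕ ⤖ List Bool
ℕ⤖nodes = ↔⇒⤖ (mk↔ₛ′ node index node-index index-node)

length≤index : ∀ l → length l ≤ index l
length≤index []          = z≤n
length≤index (true ∷ l)  = s≤s (≤-trans (length≤index l) (m≤m+n (index l) _))
length≤index (false ∷ l) = s≤s (≤-trans (length≤index l) (m≤m+n (index l) _))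

pairNode : ℕ → ℕ → List Bool
pairNode i j = replicate i true ++ false ∷ replicate j true

unpairNode : List Bool → ℕ × ℕ
unpairNode []          = 0 , 0
unpairNode (true ∷ l)  = map₁ suc (unpairNode l)
unpairNode (false ∷ l) = 0 , length l

unpairNode-pairNode : ∀ i j → unpairNode (pairNode i j) ≡ (i , j)
unpairNode-pairNode zero    j = cong (0 ,_) (length-replicate j)
unpairNode-pairNode (suc i) j = cong (map₁ suc) (unpairNode-pairNode i j)

pair : ℕ → ℕ → ℕ
pair i j = index (pairNode i j)

unpair : ℕ → ℕ × ℕ
unpair n = unpairNode (node n)

unpair-pair : ∀ i j → unpair (pair i j) ≡ (i , j)
unpair-pair i j = trans (cong unpairNode (node-index (pairNode i j))) (unpairNode-pairNode i j)

length-prefix : ∀ b k → length (prefix b k) ≡ k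
length-prefix b zero    = refl
length-prefix b (suc k) = cong suc (length-prefix (λ i → b (suc i)) k)

prefix-onBranch : ∀ b k → OnBranch b (prefix b k)
prefix-onBranch b k = cong (prefix b) (sym (length-prefix b k))

onBranch : (ℕ → Bool) → Subset
onBranch b n = does (≡-dec _≟ᵇ_ (node n) (prefix b (length (node n))))

onBranch-sound : ∀ b n → onBranch b n ≡ true → OnBranch b (node n)
onBranch-sound b n h with ≡-dec _≟ᵇ_ (node n) (prefix b (length (node n)))
... | yes on = on

onBranch-infinite : ∀ b → Infinite (onBranch b)
onBranch-infinite b N =
  index (prefix b N) ,
  subst (_≤ index (prefix b N)) (length-prefix b N) (length≤index (prefix b N)) ,
  dec-true (≡-dec _≟ᵇ_ _ _)
    (subst (OnBranch b) (sym (node-index (prefix b N))) (prefix-onBranch b N))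

module _ {z : ℕ → ℕ} (z-< : ∀ k → z k < z (suc k)) where

  strictlyIncreasing-mono : ∀ {i j} → i < j → z i < z j
  strictlyIncreasing-mono {i} {suc j} (s≤s i≤j) with m≤n⇒m<n∨m≡n i≤j
  ... | inj₁ i<j  = <-trans (strictlyIncreasing-mono i<j) (z-< j)
  ... | inj₂ refl = z-< j

  strictlyIncreasing-injective : ∀ {i j} → z i ≡ z j → i ≡ j
  strictlyIncreasing-injective {i} {j} zi≡zj with <-cmp i j
  ... | tri< i<j _ _ = contradiction zi≡zj (<⇒≢ (strictlyIncreasing-mono i<j))
  ... | tri≈ _ i≡j _ = i≡j
  ... | tri> _ _ j<i = contradiction zi≡zj (>⇒≢ (strictlyIncreasing-mono j<i))

  strictlyIncreasing-≥ : ∀ k → k ≤ z k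
  strictlyIncreasing-≥ zero    = z≤n
  strictlyIncreasing-≥ (suc k) = ≤-trans (s≤s (strictlyIncreasing-≥ k)) (z-< k)

_⊆_ : Subset → Subset → Set
X ⊆ Y = ∀ n → X n ≡ true → Y n ≡ true

InfinitelyMany : (ℕ → Set) → Set
InfinitelyMany P = ∀ N → ∃ λ n → N ≤ n × P n

IsChain-resp-⇒ : ∀ {R Q} → R ⇒ Q → ∀ {C} → IsChain R C → IsChain Q C
IsChain-resp-⇒ R⇒Q chain x y Cx Cy = Sum.map R⇒Q R⇒Q (chain x y Cx Cy)

IsBranch-resp-⇔ : ∀ {R Q} → R ⇔ Q → ∀ {C} → IsBranch R C → IsBranch Q C
IsBranch-resp-⇔ (R⇒Q , Q⇒R) (chain , maximal) =
  IsChain-resp-⇒ R⇒Q chain , λ C′ chain′ → maximal C′ (IsChain-resp-⇒ Q⇒R chain′)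

AvoidsBranches : (ℕ → ℕ → Set) → Subset → Set
AvoidsBranches R X = ∀ C → IsBranch R C → ¬ (X =* C)

AvoidsBranches-resp-⇔ : ∀ {R Q} → R ⇔ Q → ∀ {X} → AvoidsBranches R X → AvoidsBranches Q X
AvoidsBranches-resp-⇔ R⇔Q avoids C branch = avoids C (IsBranch-resp-⇔ (swap R⇔Q) branch)

BranchAvoidingSubset : (ℕ → ℕ → Set) → Subset → Set
BranchAvoidingSubset R S = Σ Subset λ X → X ⊆ S × Infinite X × AvoidsBranches R X

module Classical (em : ExcludedMiddle 0ℓ) where

  ⌊_⌋ : Set → Bool
  ⌊ P ⌋ = does (em {P})

  ⌊⌋-sound : ∀ {P} → ⌊ P ⌋ ≡ true → P
  ⌊⌋-sound {P} h with em {P}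
  ... | yes p = p

  ⌊⌋-complete : ∀ {P} → P → ⌊ P ⌋ ≡ true
  ⌊⌋-complete {P} = dec-true (em {P})

  ¬infinitelyMany⇒eventually¬ : ∀ {P} → ¬ InfinitelyMany P → ∃ λ N → ∀ n → N ≤ n → ¬ P n
  ¬infinitelyMany⇒eventually¬ {P} finite with em {∃ λ N → ∀ n → N ≤ n → ¬ P n}
  ... | yes eventually = eventually
  ... | no ¬eventually = ⊥-elim (finite infinitelyMany)
    where
      infinitelyMany : InfinitelyMany P
      infinitelyMany N with em {∃ λ n → N ≤ n × P n}
      ... | yes found = found
      ... | no none   = ⊥-elim (¬eventually (N , λ n N≤n Pn → none (n , N≤n , Pn)))

module TreeOrder (em : ExcludedMiddle 0ℓ) {_≼_ : ℕ → ℕ → Set} (tree : IsTreeOrder _≼_) where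
  open Classical em

  _≺_ : ℕ → ℕ → Set
  x ≺ y = x ≼ y × x ≢ y

  ≼-refl : ∀ n → n ≼ n
  ≼-refl = proj₁ tree

  ≼-trans : ∀ k m n → k ≼ m → m ≼ n → k ≼ n
  ≼-trans = proj₁ (proj₂ (proj₂ tree))

  root : ℕ
  root = proj₁ (proj₁ (proj₂ (proj₂ (proj₂ tree))))

  root-least : ∀ n → root ≼ n
  root-least = proj₂ (proj₁ (proj₂ (proj₂ (proj₂ tree))))

  predecessors-linear : ∀ n x y → x ≼ n → y ≼ n → x ≼ y ⊎ y ≼ x
  predecessors-linear n = proj₁ (proj₂ (proj₂ (proj₂ (proj₂ tree))) n)

  predecessors-wellFounded : ∀ n → WellFounded {A = Σ ℕ (_≼ n)} (λ p q → proj₁ p ≺ proj₁ q)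
  predecessors-wellFounded n = proj₂ (proj₂ (proj₂ (proj₂ (proj₂ tree))) n)

  branch-downClosed : ∀ {C} → IsBranch _≼_ C → ∀ {x y} → C y ≡ true → x ≼ y → C x ≡ true
  branch-downClosed {C} (chain , maximal) {x} {y} Cy x≼y =
    maximal C+x chain+x (λ n Cn → ⌊⌋-complete (inj₁ Cn)) x (⌊⌋-complete (inj₂ refl))
    where
      C+x : Subset
      C+x n = ⌊ C n ≡ true ⊎ n ≡ x ⌋

      comparable-with-x : ∀ n → C n ≡ true → x ≼ n ⊎ n ≼ x
      comparable-with-x n Cn with chain n y Cn Cy
      ... | inj₁ n≼y = predecessors-linear y x n x≼y n≼y
      ... | inj₂ y≼n = inj₁ (≼-trans x y n x≼y y≼n)

      chain+x : IsChain _≼_ C+x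
      chain+x m n m∈ n∈ with ⌊⌋-sound m∈ | ⌊⌋-sound n∈
      ... | inj₁ Cm   | inj₁ Cn   = chain m n Cm Cn
      ... | inj₁ Cm   | inj₂ refl = Sum.swap (comparable-with-x m Cm)
      ... | inj₂ refl | inj₁ Cn   = comparable-with-x n Cn
      ... | inj₂ refl | inj₂ refl = inj₁ (≼-refl x)

  NotDownClosedAtInfinity : Subset → Set
  NotDownClosedAtInfinity X =
    ∀ M → ∃₂ λ x y → M ≤ x × M ≤ y × X x ≢ true × X y ≡ true × x ≼ y

  notDownClosedAtInfinity⇒avoidsBranches : ∀ {X} → NotDownClosedAtInfinity X → AvoidsBranches _≼_ X
  notDownClosedAtInfinity⇒avoidsBranches gaps C branch (M , X≡C) =
    let (x , y , M≤x , M≤y , x∉X , y∈X , x≼y) = gaps M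
        Cy = trans (sym (X≡C y M≤y)) y∈X
    in x∉X (trans (X≡C x M≤x) (branch-downClosed branch Cy x≼y))

  record AscendingSequence (D : Subset) : Set where
    field
      term   : ℕ → ℕ
      term∈D : ∀ k → D (term k) ≡ true
      term-< : ∀ k → term k < term (suc k)
      term-≺ : ∀ k → term k ≺ term (suc k)

  ascending⇒branchAvoidingSubset : ∀ {D} → AscendingSequence D → BranchAvoidingSubset _≼_ D
  ascending⇒branchAvoidingSubset {D} z =
    evenTerms , evenTerms⊆D , evenTerms-infinite , notDownClosedAtInfinity⇒avoidsBranches gaps
    where
      open AscendingSequence z

      evenTerms : Subset
      evenTerms n = ⌊ ∃ (λ k → term (2 * k) ≡ n) ⌋

      evenTerms⊆D : evenTerms ⊆ D
      evenTerms⊆D n n∈ = let (k , term≡n) = ⌊⌋-sound n∈ in subst (λ m → D m ≡ true) term≡n (term∈D (2 * k))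

      evenTerms-infinite : Infinite evenTerms
      evenTerms-infinite N =
        term (2 * N) , ≤-trans (m≤n*m N 2) (strictlyIncreasing-≥ term-< (2 * N)) , ⌊⌋-complete (N , refl)

      oddTerm∉evenTerms : ∀ M → evenTerms (term (suc (2 * M))) ≢ true
      oddTerm∉evenTerms M odd∈ =
        let (k , even≡odd) = ⌊⌋-sound odd∈
        in even≢odd k M (strictlyIncreasing-injective term-< even≡odd)

      gaps : NotDownClosedAtInfinity evenTerms
      gaps M =
        term (suc (2 * M)) , term (suc (suc (2 * M))) ,
        M≤term (suc (2 * M)) (≤-trans (m≤n*m M 2) (n≤1+n _)) ,
        M≤term (suc (suc (2 * M))) (≤-trans (m≤n*m M 2) (≤-trans (n≤1+n _) (n≤1+n _))) ,
        oddTerm∉evenTerms M ,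
        ⌊⌋-complete (suc M , cong term (*-suc 2 M)) ,
        proj₁ (term-≺ (suc (2 * M)))
        where
          M≤term : ∀ k → M ≤ k → M ≤ term k
          M≤term k M≤k = ≤-trans M≤k (strictlyIncreasing-≥ term-< k)

  module InfiniteChain {D : Subset} (D-chain : IsChain _≼_ D) (D-infinite : Infinite D) where

    Above : ℕ → ℕ → Set
    Above a y = D y ≡ true × a ≺ y

    Unbounded : ℕ → Set
    Unbounded a = InfinitelyMany (Above a)

    root-unbounded : Unbounded root
    root-unbounded N =
      let (n , N+root<n , Dn) = D-infinite (N + suc root)
          root<n = ≤-trans (m≤n+m (suc root) N) N+root<n
      in n , ≤-trans (m≤m+n N _) N+root<n , Dn , root-least n , <⇒≢ root<n

    module Stuck {a : ℕ} (a-unbounded : Unbounded a) (M : ℕ)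
                 (stuck : ∀ x → M ≤ x → Above a x → ¬ Unbounded x) where

      -- Points of D above x are eventually exhausted, so a far enough point of D
      -- above a is comparable with x but cannot lie above it.
      lower : ∀ x → M ≤ x → Above a x → ∃ λ y → M ≤ y × Above a y × y ≺ x
      lower x M≤x above-x with ¬infinitelyMany⇒eventually¬ (stuck x M≤x above-x)
      ... | Nx , exhausted with a-unbounded (Nx + M + suc x)
      ... | y , bound≤y , above-y with D-chain x y (proj₁ above-x) (proj₁ above-y)
      ... | inj₁ x≼y = contradiction (proj₁ above-y , x≼y , <⇒≢ x<y)
                         (exhausted y (≤-trans (≤-trans (m≤m+n Nx M) (m≤m+n _ _)) bound≤y))
        where x<y = ≤-trans (m≤n+m (suc x) (Nx + M)) bound≤y
      ... | inj₂ y≼x = y , ≤-trans (≤-trans (m≤n+m M Nx) (m≤m+n _ _)) bound≤y , above-y , y≼x , >⇒≢ x<y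
        where x<y = ≤-trans (m≤n+m (suc x) (Nx + M)) bound≤y

      noDescent : ∀ {e} (p : Σ ℕ (_≼ e)) → Acc (λ p q → proj₁ p ≺ proj₁ q) p →
                  M ≤ proj₁ p → Above a (proj₁ p) → ⊥
      noDescent {e} (x , x≼e) (acc smaller) M≤x above-x =
        let (y , M≤y , above-y , y≺x) = lower x M≤x above-x
        in noDescent (y , ≼-trans y x e (proj₁ y≺x) x≼e) (smaller y≺x) M≤y above-y

    unbounded-successor : ∀ {a} → Unbounded a → ∀ M → ∃ λ a′ → M ≤ a′ × Above a a′ × Unbounded a′
    unbounded-successor {a} a-unbounded M with em {∃ λ a′ → M ≤ a′ × Above a a′ × Unbounded a′}
    ... | yes found = found
    ... | no none =
      let (e , M≤e , above-e) = a-unbounded M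
      in ⊥-elim (Stuck.noDescent a-unbounded M (λ x M≤x above-x u → none (x , M≤x , above-x , u))
           (e , ≼-refl e) (predecessors-wellFounded e _) M≤e above-e)

    next : Σ ℕ Unbounded → Σ ℕ Unbounded
    next (a , u) = let (a′ , _ , _ , u′) = unbounded-successor u (suc a) in a′ , u′

    next-spec : ∀ p → proj₁ p < proj₁ (next p) × Above (proj₁ p) (proj₁ (next p))
    next-spec (a , u) = let (_ , a<a′ , above , _) = unbounded-successor u (suc a) in a<a′ , above

    unboundedChain : ℕ → Σ ℕ Unbounded
    unboundedChain zero    = root , root-unbounded
    unboundedChain (suc k) = next (unboundedChain k)

    ascendingSequence : AscendingSequence D
    ascendingSequence = record
      { term   = λ k → proj₁ (unboundedChain (suc k))
      ; term∈D = λ k → proj₁ (proj₂ (next-spec (unboundedChain k)))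
      ; term-< = λ k → proj₁ (next-spec (unboundedChain (suc k)))
      ; term-≺ = λ k → proj₂ (proj₂ (next-spec (unboundedChain (suc k))))
      }

  almostBranch⇒branchAvoidingSubset : ∀ {S C} → Infinite S → IsBranch _≼_ C → S =* C →
                                      BranchAvoidingSubset _≼_ S
  almostBranch⇒branchAvoidingSubset {S} {C} S-infinite (C-chain , _) (M , S≡C) =
    let (X , X⊆D , rest) = ascending⇒branchAvoidingSubset (InfiniteChain.ascendingSequence D-chain D-infinite)
    in X , (λ n → D⊆S n ∘ X⊆D n) , rest
    where
      D : Subset
      D n = S n ∧ C n

      D⊆S : D ⊆ S
      D⊆S n = ∧-conicalˡ (S n) (C n)

      D-chain : IsChain _≼_ D
      D-chain x y Dx Dy = C-chain x y (∧-conicalʳ (S x) (C x) Dx) (∧-conicalʳ (S y) (C y) Dy)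

      D-infinite : Infinite D
      D-infinite N =
        let (n , N+M≤n , Sn) = S-infinite (N + M)
            Cn = trans (sym (S≡C n (≤-trans (m≤n+m M N) N+M≤n))) Sn
        in n , ≤-trans (m≤m+n N M) N+M≤n , cong₂ _∧_ Sn Cn

codedRelation : Subset → ℕ → ℕ → Set
codedRelation b i j = b (pair i j) ≡ true

module Tops (em : ExcludedMiddle 0ℓ) where
  open Classical em

  code : (ℕ → ℕ → Set) → Subset
  code R n = ⌊ R (proj₁ (unpair n)) (proj₂ (unpair n)) ⌋

  codedRelation-code : ∀ R → codedRelation (code R) ⇔ R
  codedRelation-code R =
    (λ {i} {j} h → subst (λ p → R (proj₁ p) (proj₂ p)) (unpair-pair i j) (⌊⌋-sound h)) ,
    (λ {i} {j} r → ⌊⌋-complete (subst (λ p → R (proj₁ p) (proj₂ p)) (sym (unpair-pair i j)) r))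

  Defeating : Subset → Set
  Defeating b = BranchAvoidingSubset (codedRelation b) (onBranch b)

  chooseTop : ∀ b → Dec (Defeating b) → Subset
  chooseTop b (yes (X , _)) = X
  chooseTop b (no _)        = onBranch b

  top : Subset → Subset
  top b = chooseTop b (em {Defeating b})

  chooseTop-onBranch : ∀ b d → Infinite (chooseTop b d) × (∀ n → chooseTop b d n ≡ true → OnBranch b (node n))
  chooseTop-onBranch b (yes (X , X⊆ , X-infinite , _)) = X-infinite , λ n → onBranch-sound b n ∘ X⊆ n
  chooseTop-onBranch b (no _)                          = onBranch-infinite b , onBranch-sound b

  chooseTop-avoidsBranches : ∀ {_≼_} → IsTreeOrder _≼_ → ∀ {b} → codedRelation b ⇔ _≼_ →
                             ∀ d → AvoidsBranches _≼_ (chooseTop b d)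
  chooseTop-avoidsBranches tree coded (yes (_ , _ , _ , avoids)) = AvoidsBranches-resp-⇔ coded avoids
  chooseTop-avoidsBranches tree {b} coded (no ¬defeating) C branch onBranch≡C =
    let (X , X⊆ , X-infinite , avoids) = TreeOrder.almostBranch⇒branchAvoidingSubset em tree
                                           (onBranch-infinite b) branch onBranch≡C
    in ¬defeating (X , X⊆ , X-infinite , AvoidsBranches-resp-⇔ (swap coded) avoids)

mainTheorem3 : ExcludedMiddle 0ℓ → CH →
    Σ (ℕ ⤖ List Bool) λ e → Σ Family λ B → Σ (Subset → Subset) λ N →
      IsBinaryTreeWithTops e B N × ¬ IsTreeFamily (NbhdFamily B N)
mainTheorem3 em ch =
  ℕ⤖nodes , allBranches , top , (ch , λ b _ → chooseTop-onBranch b (em {Defeating b})) , notTreeFamily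
  where
    open Tops em

    allBranches : Family
    allBranches _ = Subset

    notTreeFamily : ¬ IsTreeFamily (NbhdFamily allBranches top)
    notTreeFamily (_ , _ , _≼_ , tree , almostBranches) =
      let b = code _≼_
          (C , branch , top≡C) = almostBranches (top b) (b , b , λ _ → refl)
      in chooseTop-avoidsBranches tree (codedRelation-code _≼_) (em {Defeating b}) C branch top≡C
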